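{- For each $n\in\mathbb N$, $$1\le\liminf_{x\to+\infty}\frac{\mathbb P^T_n(x)}{\mathrm{Diag}\,\mathbb P(x)}\le\limsup_{x\to+\infty}\frac{\mathbb P^T_n(x)}{\mathrm{Diag}\,\mathbb P(x)}\le2.$$ In particular, $\mathrm{Diag}\,\mathbb P(x)=\Theta(\mathbb P^T_n(x))$ as $x\to+\infty$.
   Context: Let $p_n$ denote the $n$-th prime number ($p_1=2$). Define $p^{(0)}_n=n$ and recursively $p^{(k+1)}_n=p_{p^{(k)}_n}$ for $k\in\mathbb N_0$. For $n\in\mathbb N$, $\mathbb P^T_n=\{p^{(k)}_n: k\in\mathbb N\}$, and $\mathrm{Diag}\,\mathbb P=\{p^{(k)}_k: k\in\mathbb N\}$. For $A\subset\mathbb N$ and $x\ge1$, $A(x)=\#\{a\in A:a\le x\}$. -}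

module Defs where

open import Data.Nat using (ℕ; zero; suc; _+_; _*_; _≤_; _!)
open import Relation.Binary.PropositionalEquality using (_≡_)
open import Data.Nat.Primality using (prime?)
open import Data.List using (List; length)
open import Data.List.Membership.Propositional using (_∈_)
open import Data.List.Relation.Unary.Unique.Propositional using (Unique)
open import Data.Product using (Σ; _×_)
open import Function.Bundles using (_⇔_)
open import Relation.Nullary using (yes; no)

-- firstPrimeFrom s f : the least prime among s, s+1, ..., s+f-1
-- (fallback value s+f if there is none; never reached below).
firstPrimeFrom : ℕ → ℕ → ℕ
firstPrimeFrom s zero = s
firstPrimeFrom s (suc f) with prime? s
... | yes _ = s
... | no  _ = firstPrimeFrom (suc s) f

-- the least prime > m; it lies in (m, m + m!] because m! + 1 has a prime
-- factor > m (Euclid), so the bounded search always succeeds for m ≥ 1.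
nextPrime : ℕ → ℕ
nextPrime m = firstPrimeFrom (suc m) (m !)

-- p n = p_n, the n-th prime, p 1 = 2 (p 0 is an unused dummy value).
p : ℕ → ℕ
p zero = 0
p (suc zero) = 2
p (suc (suc k)) = nextPrime (p (suc k))

iter : ℕ → ℕ → ℕ
iter zero n = n
iter (suc k) n = p (iter k n)

PT : ℕ → ℕ → Set
PT n a = Σ ℕ (λ k → (1 ≤ k) × (iter k n ≡ a))

Diag : ℕ → Set
Diag a = Σ ℕ (λ k → (1 ≤ k) × (iter k k ≡ a))

CountIs : (ℕ → Set) → ℕ → ℕ → Set
CountIs A x c =
  Σ (List ℕ) (λ l → Unique l × ((∀ a → (a ∈ l) ⇔ ((a ≤ x) × A a)) × (length l ≡ c)))

-- Both P^T_n and Diag P are the ranges of strictly increasing sequences on k ≥ 1,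
-- f k = p^{(k)}_n and g k = p^{(k)}_k, so their counting functions are the numbers
-- of indices k ≥ 1 with f k ≤ x, resp. g k ≤ x. Since p^{(k)} is increasing,
-- f k ≤ g k as soon as k ≥ n, whence Diag P(x) ≤ n + P^T_n(x); and since k ≤ f k,
-- g k ≤ p^{(k)}(f k) = f (2k), whence P^T_n(x) ≤ 1 + 2 Diag P(x). Both counts tend
-- to infinity, which absorbs the additive constants.
module Submission where

open import Defs
open import Data.Nat using (ℕ; zero; suc; _+_; _*_; _≤_; _<_; z≤n; s≤s; _≟_; _≤?_; _<?_; _!;
  _≤′_; ≤′-refl; ≤′-step)
open import Data.Nat.Primality using (prime?)
open import Data.Nat.Properties
open import Data.Nat.Tactic.RingSolver using (solve-∀)
open import Data.Product using (Σ; ∃-syntax; _×_; _,_; proj₂)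
open import Data.Sum using (_⊎_; inj₁; inj₂)
open import Data.List using (List; []; _∷_; length; map; filter; upTo; _++_)
open import Data.List.Properties using (length-map; length-++; length-upTo; filter-notAll)
open import Data.List.Membership.Propositional using (_∈_)
open import Data.List.Membership.Propositional.Properties
  using (∈-map⁺; ∈-map⁻; ∈-++⁺ˡ; ∈-++⁺ʳ; ∈-upTo⁺; ∈-upTo⁻; ∈-filter⁺; ∈-filter⁻)
open import Data.List.Relation.Binary.Subset.Propositional using (_⊆_)
open import Data.List.Relation.Unary.Any using (Any; here; there)
import Data.List.Relation.Unary.Any as Any
open import Data.List.Relation.Unary.All using () renaming (lookup to All-lookup)
open import Data.List.Relation.Unary.AllPairs using ([]; _∷_)
open import Data.List.Relation.Unary.Unique.Propositional using (Unique)
import Data.List.Relation.Unary.Unique.Propositional.Properties as Unique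
open import Function.Base using (_∘_)
open import Function.Bundles using (Equivalence)
open import Function.Definitions using (Injective)
open import Relation.Binary.Definitions using (DecidableEquality; Monotonic₁; tri<; tri≈; tri>)
open import Relation.Binary.PropositionalEquality
open import Relation.Nullary using (¬_; ¬?; yes; no)
open import Relation.Nullary.Decidable using (_×-dec_)
open import Relation.Unary using (Decidable)
open import Data.Empty using (⊥-elim)

module _ {a} {A : Set a} (_≟A_ : DecidableEquality A) where

  Unique⇒length-mono-⊆ : ∀ {xs ys : List A} → Unique xs → xs ⊆ ys → length xs ≤ length ys
  Unique⇒length-mono-⊆ {[]} _ _ = z≤n
  Unique⇒length-mono-⊆ {x ∷ xs} {ys} (x∉xs ∷ xs!) x∷xs⊆ys = begin
    suc (length xs)           ≤⟨ s≤s (Unique⇒length-mono-⊆ xs! xs⊆ys-x) ⟩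
    suc (length (filter ≢x? ys)) ≤⟨ filter-notAll ≢x? ys x∈ys ⟩
    length ys                 ∎
    where
    open ≤-Reasoning
    ≢x? : Decidable (λ y → ¬ x ≡ y)
    ≢x? = ¬? ∘ (x ≟A_)
    x∈ys : Any (λ y → ¬ ¬ x ≡ y) ys
    x∈ys = Any.map (λ x≡y x≢y → x≢y x≡y) (x∷xs⊆ys (here refl))
    xs⊆ys-x : xs ⊆ filter ≢x? ys
    xs⊆ys-x z∈xs = ∈-filter⁺ ≢x? (x∷xs⊆ys (there z∈xs)) (All-lookup x∉xs z∈xs)

StrictlyIncreasing : (ℕ → ℕ) → Set
StrictlyIncreasing h = ∀ k → h k < h (suc k)

-- PT n and Diag are, definitionally, Range (λ k → iter k n) and Range (λ k → iter k k).
Range : (ℕ → ℕ) → ℕ → Set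
Range h a = Σ ℕ (λ k → (1 ≤ k) × (h k ≡ a))

module StrictlyIncreasingSequence {h : ℕ → ℕ} (h-inc : StrictlyIncreasing h) where

  mono-≤ : Monotonic₁ _≤_ _≤_ h
  mono-≤ {i} i≤j = mono-≤′ (≤⇒≤′ i≤j)
    where
    mono-≤′ : ∀ {j} → i ≤′ j → h i ≤ h j
    mono-≤′ ≤′-refl       = ≤-refl
    mono-≤′ (≤′-step i≤j) = ≤-trans (mono-≤′ i≤j) (<⇒≤ (h-inc _))

  mono-< : Monotonic₁ _<_ _<_ h
  mono-< {i} i<j = <-≤-trans (h-inc i) (mono-≤ i<j)

  injective : Injective _≡_ _≡_ h
  injective {i} {j} hi≡hj with <-cmp i j
  ... | tri< i<j _ _ = ⊥-elim (<-irrefl hi≡hj (mono-< i<j))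
  ... | tri≈ _ i≡j _ = i≡j
  ... | tri> _ _ i>j = ⊥-elim (<-irrefl (sym hi≡hj) (mono-< i>j))

  n≤h[n] : ∀ k → k ≤ h k
  n≤h[n] zero    = z≤n
  n≤h[n] (suc k) = ≤-<-trans (n≤h[n] k) (h-inc k)

  positive-index-below? : ∀ x → Decidable (λ k → (1 ≤ k) × (h k ≤ x))
  positive-index-below? x k = (1 ≤? k) ×-dec (h k ≤? x)

  -- Searching up to x suffices since k ≤ h k.
  indices : ℕ → List ℕ
  indices x = filter (positive-index-below? x) (upTo (suc x))

  indices-unique : ∀ x → Unique (indices x)
  indices-unique x = Unique.filter⁺ (positive-index-below? x) (Unique.upTo⁺ (suc x))

  ∈-indices⁺ : ∀ {x k} → 1 ≤ k → h k ≤ x → k ∈ indices x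
  ∈-indices⁺ {x} {k} 1≤k hk≤x =
    ∈-filter⁺ (positive-index-below? x) (∈-upTo⁺ (s≤s (≤-trans (n≤h[n] k) hk≤x))) (1≤k , hk≤x)

  ∈-indices⁻ : ∀ {x k} → k ∈ indices x → (1 ≤ k) × (h k ≤ x)
  ∈-indices⁻ {x} k∈ = proj₂ (∈-filter⁻ (positive-index-below? x) {xs = upTo (suc x)} k∈)

  count≡length-indices : ∀ {x c} → CountIs (Range h) x c → c ≡ length (indices x)
  count≡length-indices {x} {c} (l , l! , l↔ , ∣l∣≡c) = ≤-antisym
    (subst₂ _≤_ ∣l∣≡c ∣image∣≡ (Unique⇒length-mono-⊆ _≟_ l! l⊆image))
    (subst₂ _≤_ ∣image∣≡ ∣l∣≡c (Unique⇒length-mono-⊆ _≟_ image! image⊆l))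
    where
    image : List ℕ
    image = map h (indices x)
    image! : Unique image
    image! = Unique.map⁺ injective (indices-unique x)
    ∣image∣≡ : length image ≡ length (indices x)
    ∣image∣≡ = length-map h (indices x)
    l⊆image : l ⊆ image
    l⊆image {z} z∈l with Equivalence.to (l↔ z) z∈l
    ... | z≤x , k , 1≤k , refl = ∈-map⁺ h (∈-indices⁺ 1≤k z≤x)
    image⊆l : image ⊆ l
    image⊆l z∈image with ∈-map⁻ h z∈image
    ... | k , k∈ , refl with ∈-indices⁻ k∈
    ...   | 1≤k , hk≤x = Equivalence.from (l↔ (h k)) (hk≤x , k , 1≤k , refl)

  k≤length-indices : ∀ {x} k → h k ≤ x → k ≤ length (indices x)
  k≤length-indices {x} k hk≤x = subst (_≤ length (indices x)) ∣first-k∣≡k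
    (Unique⇒length-mono-⊆ _≟_ (Unique.map⁺ suc-injective (Unique.upTo⁺ k)) first-k⊆indices)
    where
    ∣first-k∣≡k : length (map suc (upTo k)) ≡ k
    ∣first-k∣≡k = trans (length-map suc (upTo k)) (length-upTo k)
    first-k⊆indices : map suc (upTo k) ⊆ indices x
    first-k⊆indices i∈ with ∈-map⁻ suc i∈
    ... | i , i<k , refl = ∈-indices⁺ (s≤s z≤n) (≤-trans (mono-≤ (∈-upTo⁻ i<k)) hk≤x)

module _ {f g : ℕ → ℕ} (f-inc : StrictlyIncreasing f) (g-inc : StrictlyIncreasing g) where

  private
    module F = StrictlyIncreasingSequence f-inc
    module G = StrictlyIncreasingSequence g-inc

  eventually-≤⇒length-indices-≤ : ∀ n → (∀ {k} → n ≤ k → f k ≤ g k) → ∀ x →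
    length (G.indices x) ≤ n + length (F.indices x)
  eventually-≤⇒length-indices-≤ n f≤g x =
    subst (length (G.indices x) ≤_) ∣cover∣≡ (Unique⇒length-mono-⊆ _≟_ (G.indices-unique x) cover)
    where
    ∣cover∣≡ : length (upTo n ++ F.indices x) ≡ n + length (F.indices x)
    ∣cover∣≡ = trans (length-++ (upTo n)) (cong (_+ length (F.indices x)) (length-upTo n))
    cover : G.indices x ⊆ upTo n ++ F.indices x
    cover {k} k∈ with k <? n | G.∈-indices⁻ {x} k∈
    ... | yes k<n | _ = ∈-++⁺ˡ (∈-upTo⁺ k<n)
    ... | no k≮n | 1≤k , gk≤x = ∈-++⁺ʳ (upTo n) (F.∈-indices⁺ {x} 1≤k (≤-trans (f≤g (≮⇒≥ k≮n)) gk≤x))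

  private
    double : ℕ → ℕ
    double k = k + k

    halve : ∀ j → ∃[ k ] (double k ≡ j ⊎ suc (double k) ≡ j)
    halve zero       = 0 , inj₁ refl
    halve (suc zero) = 0 , inj₂ refl
    halve (suc (suc j)) with halve j
    ... | k , inj₁ refl = suc k , inj₁ (cong suc (+-suc k k))
    ... | k , inj₂ refl = suc k , inj₂ (cong (suc ∘ suc) (+-suc k k))

  ≤-double⇒length-indices-≤ : (∀ k → g k ≤ f (double k)) → ∀ x →
    length (F.indices x) ≤ suc (length (G.indices x) + length (G.indices x))
  ≤-double⇒length-indices-≤ g≤f∘double x =
    subst (length (F.indices x) ≤_) ∣cover∣≡ (Unique⇒length-mono-⊆ _≟_ (F.indices-unique x) cover)
    where
    Gs : List ℕ
    Gs = G.indices x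
    ∣cover∣≡ : length (1 ∷ map double Gs ++ map (suc ∘ double) Gs) ≡ suc (length Gs + length Gs)
    ∣cover∣≡ = cong suc (trans (length-++ (map double Gs))
                              (cong₂ _+_ (length-map double Gs) (length-map (suc ∘ double) Gs)))
    ∈Gs : ∀ {k j} → double (suc k) ≤ j → f j ≤ x → suc k ∈ Gs
    ∈Gs {k} 2k≤j fj≤x = G.∈-indices⁺ (s≤s z≤n)
      (≤-trans (g≤f∘double (suc k)) (≤-trans (F.mono-≤ 2k≤j) fj≤x))
    cover : F.indices x ⊆ 1 ∷ map double Gs ++ map (suc ∘ double) Gs
    cover {j} j∈ with F.∈-indices⁻ {x} j∈ | halve j
    ... | () , _    | zero , inj₁ refl
    ... | _         | zero , inj₂ refl = here refl
    ... | _ , fj≤x  | suc k , inj₁ refl =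
      there (∈-++⁺ˡ (∈-map⁺ double (∈Gs ≤-refl fj≤x)))
    ... | _ , fj≤x  | suc k , inj₂ refl =
      there (∈-++⁺ʳ (map double Gs) (∈-map⁺ (suc ∘ double) (∈Gs (n≤1+n _) fj≤x)))

firstPrimeFrom-≥ : ∀ s t → s ≤ firstPrimeFrom s t
firstPrimeFrom-≥ s zero = ≤-refl
firstPrimeFrom-≥ s (suc t) with prime? s
... | yes _ = ≤-refl
... | no  _ = ≤-trans (n≤1+n s) (firstPrimeFrom-≥ (suc s) t)

p-increasing : StrictlyIncreasing p
p-increasing zero    = s≤s z≤n
p-increasing (suc k) = firstPrimeFrom-≥ (suc (p (suc k))) (p (suc k) !)

private
  module P = StrictlyIncreasingSequence p-increasing

n<p[n] : ∀ {a} → 1 ≤ a → a < p a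
n<p[n] {suc zero}    _ = s≤s (s≤s z≤n)
n<p[n] {suc (suc a)} _ = ≤-<-trans (n<p[n] {suc a} (s≤s z≤n)) (p-increasing (suc a))

iter-mono-≤ : ∀ k → Monotonic₁ _≤_ _≤_ (iter k)
iter-mono-≤ zero    a≤b = a≤b
iter-mono-≤ (suc k) a≤b = P.mono-≤ (iter-mono-≤ k a≤b)

iter-mono-< : ∀ k → Monotonic₁ _<_ _<_ (iter k)
iter-mono-< zero    a<b = a<b
iter-mono-< (suc k) a<b = P.mono-< (iter-mono-< k a<b)

iter-+ : ∀ j k a → iter (j + k) a ≡ iter j (iter k a)
iter-+ zero    k a = refl
iter-+ (suc j) k a = cong p (iter-+ j k a)

n≤iter : ∀ k a → a ≤ iter k a
n≤iter zero    a = ≤-refl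
n≤iter (suc k) a = ≤-trans (n≤iter k a) (P.n≤h[n] (iter k a))

tower-increasing : ∀ {n} → 1 ≤ n → StrictlyIncreasing (λ k → iter k n)
tower-increasing {n} 1≤n k = n<p[n] (≤-trans 1≤n (n≤iter k n))

diagonal-increasing : StrictlyIncreasing (λ k → iter k k)
diagonal-increasing k = <-≤-trans (iter-mono-< k (n<1+n k)) (P.n≤h[n] _)

lower-ratio-bound : ∀ m n {c d} → d ≤ n + c → m * n ≤ c → m * d ≤ suc m * c
lower-ratio-bound m n {c} {d} d≤n+c mn≤c = begin
  m * d         ≤⟨ *-monoʳ-≤ m d≤n+c ⟩
  m * (n + c)   ≡⟨ *-distribˡ-+ m n c ⟩
  m * n + m * c ≤⟨ +-monoˡ-≤ (m * c) mn≤c ⟩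
  c + m * c     ∎
  where open ≤-Reasoning

upper-ratio-bound : ∀ m {c d} → c ≤ suc (d + d) → suc m ≤ d → suc m * c ≤ (2 * suc m + 1) * d
upper-ratio-bound m {c} {d} c≤2d+1 m<d = begin
  suc m * c                     ≤⟨ *-monoʳ-≤ (suc m) c≤2d+1 ⟩
  suc m * suc (d + d)           ≡⟨ expand m d ⟩
  suc m + suc m * (d + d)       ≤⟨ +-monoˡ-≤ (suc m * (d + d)) m<d ⟩
  d + suc m * (d + d)           ≡⟨ collect m d ⟩
  (2 * suc m + 1) * d           ∎
  where
  open ≤-Reasoning
  expand : ∀ m d → suc m * suc (d + d) ≡ suc m + suc m * (d + d)
  expand = solve-∀
  collect : ∀ m d → d + suc m * (d + d) ≡ (2 * suc m + 1) * d
  collect = solve-∀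

theorem17 : (n : ℕ) → 1 ≤ n → (m : ℕ) →
    Σ ℕ (λ X → (x c d : ℕ) → X ≤ x → CountIs (PT n) x c → CountIs Diag x d →
      (1 ≤ d) × ((m * d ≤ suc m * c) × (suc m * c ≤ (2 * suc m + 1) * d)))
theorem17 n 1≤n m = iter D n + iter D D , bounds
  where
  f-inc : StrictlyIncreasing (λ k → iter k n)
  f-inc = tower-increasing 1≤n
  module F = StrictlyIncreasingSequence f-inc
  module G = StrictlyIncreasingSequence diagonal-increasing
  D : ℕ
  D = suc (m + m * n)
  bounds : ∀ x c d → iter D n + iter D D ≤ x → CountIs (PT n) x c → CountIs Diag x d →
    (1 ≤ d) × ((m * d ≤ suc m * c) × (suc m * c ≤ (2 * suc m + 1) * d))
  bounds x c d X≤x #PT #Diag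
    with refl ← F.count≡length-indices #PT | refl ← G.count≡length-indices #Diag =
    ≤-trans (s≤s z≤n) D≤d ,
    lower-ratio-bound m n d≤n+c (≤-trans (m≤n+m (m * n) (suc m)) D≤c) ,
    upper-ratio-bound m c≤2d+1 (≤-trans (s≤s (m≤m+n m (m * n))) D≤d)
    where
    D≤c : D ≤ c
    D≤c = F.k≤length-indices D (≤-trans (m≤m+n _ _) X≤x)
    D≤d : D ≤ d
    D≤d = G.k≤length-indices D (≤-trans (m≤n+m _ _) X≤x)
    d≤n+c : d ≤ n + c
    d≤n+c = eventually-≤⇒length-indices-≤ f-inc diagonal-increasing n (λ {k} → iter-mono-≤ k) x
    c≤2d+1 : c ≤ suc (d + d)
    c≤2d+1 = ≤-double⇒length-indices-≤ f-inc diagonal-increasing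
      (λ k → subst (iter k k ≤_) (sym (iter-+ k k n)) (iter-mono-≤ k (F.n≤h[n] k))) x
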